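{- Let $d$ be a degree sequence and let $t$ be a positive integer. Then $d$ is $t$-tot-bigraphic if and only if there exists a balanced partition $(a,b)\in \mathrm{BP}(d)$ such that the pair $(a\circ(1^t),\, b\circ(1^t))$ is bigraphic.
   Context: A degree sequence is a non-increasing sequence $d=(d_1,\dots,d_n)$ of positive integers with even sum $\sum d=\sum_i d_i$. All multigraphs are loopless (parallel edges allowed, self-loops not). For a multigraph $H=(V,E)$ ($E$ a multiset), the underlying graph is the simple graph obtained by keeping one copy of each edge; $\mathrm{TotMult}(H)=|E|-|E'|$ where $E'$ is the edge set of the underlying graph (the total number of excess edge copies). A multigraph is bipartite if its underlying graph is bipartite. $d$ is $t$-tot-bigraphic if there is a bipartite multigraph $H$ whose degree sequence is $d$ and $\mathrm{TotMult}(H)\le t$. A block of $d$ is a subsequence of total sum $\sum d/2$; $\mathrm{BP}(d)$ is the set of pairs $\{a,b\}$ of complementary blocks with $a\circ b=d$, where $\circ$ denotes concatenation (re-sorted in non-increasing order) and $1^t$ denotes $t$ entries equal to $1$. A pair $(a,b)$ is bigraphic if there is a simple bipartite graph $G=(A,B,E)$ in which the degree sequence of the vertices of $A$ is $a$ and that of $B$ is $b$. -}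

module Defs where

open import Data.Nat using (ℕ; zero; suc; _+_; _*_; _∸_; _≤_; _<_; _≥_; _<?_)
open import Data.Nat.Divisibility using (_∣_)
open import Data.Fin using (Fin; toℕ)
open import Data.Bool using (Bool; true; false; if_then_else_)
open import Data.List using (List; length; lookup; replicate; _++_)
open import Data.Nat.ListAction using (sum)
open import Data.List.Relation.Unary.All using (All)
open import Data.List.Relation.Unary.Linked using (Linked)
open import Data.List.Relation.Ternary.Interleaving.Propositional using (Interleaving)
open import Data.Product using (Σ; _×_; ∃; ∃-syntax)
open import Relation.Binary.PropositionalEquality using (_≡_; _≢_)
open import Relation.Nullary.Decidable using (does)

Σ[<_] : (n : ℕ) → (Fin n → ℕ) → ℕ
Σ[< zero ] f = 0
Σ[< suc n ] f = f Fin.zero + Σ[< n ] (λ i → f (Fin.suc i))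

record DegreeSequence (d : List ℕ) : Set where
  field
    nonIncreasing : Linked _≥_ d
    positive      : All (λ x → 1 ≤ x) d
    evenSum       : 2 ∣ sum d

record Multigraph (n : ℕ) : Set where
  field
    mult      : Fin n → Fin n → ℕ
    symmetric : ∀ i j → mult i j ≡ mult j i
    loopless  : ∀ i → mult i i ≡ 0
open Multigraph public

degree : ∀ {n} → Multigraph n → Fin n → ℕ
degree H i = Σ[< _ ] (λ j → mult H i j)

-- total number of excess edge copies: sum over unordered pairs {j,i} (j < i)
-- of (multiplicity − 1) for present edges (and 0 for absent ones, since 0 ∸ 1 = 0)
TotMult : ∀ {n} → Multigraph n → ℕ
TotMult H = Σ[< _ ] (λ i → Σ[< _ ] (λ j →
  if does (toℕ j <? toℕ i) then mult H i j ∸ 1 else 0))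

IsBipartite : ∀ {n} → Multigraph n → Set
IsBipartite {n} H = Σ (Fin n → Bool) (λ c → ∀ (i j : Fin n) → 1 ≤ mult H i j → c i ≢ c j)

HasDegrees : (d : List ℕ) → Multigraph (length d) → Set
HasDegrees d H = ∀ i → degree H i ≡ lookup d i

TotBigraphic : ℕ → List ℕ → Set
TotBigraphic t d = ∃[ H ] (HasDegrees d H × IsBipartite H × TotMult H ≤ t)

Bigraphic : List ℕ → List ℕ → Set
Bigraphic a b =
  Σ (Fin (length a) → Fin (length b) → Bool) (λ E → (∀ i → Σ[< length b ] (λ j → if E i j then 1 else 0) ≡ lookup a i)
        × (∀ j → Σ[< length a ] (λ i → if E i j then 1 else 0) ≡ lookup b j))

IsBlock : List ℕ → List ℕ → Set
IsBlock d a = 2 * sum a ≡ sum d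

-- {a , b} ∈ BP(d): a and b are complementary subsequences of d (d is an
-- interleaving of a and b, i.e. a ∘ b = d) and both are blocks
InBP : List ℕ → List ℕ → List ℕ → Set
InBP d a b = Interleaving a b d × IsBlock d a × IsBlock d b

ones : ℕ → List ℕ
ones t = replicate t 1

-- Splitting a bipartite multigraph along its colour classes gives complementary blocks
-- (a, b) of d and a matrix M of edge multiplicities with row sums a, column sums b and
-- Σ (M i j ∸ 1) = TotMult. Adding a vertex of degree 1 to each side trades one surplus
-- edge copy: a surplus copy of an edge ij is rerouted as i–v and u–j through the new
-- vertices u and v (and when there is no surplus, u and v are joined to each other);
-- conversely u and v are either joined to each other or to some i and j, and then merge
-- back into one more copy of ij. After t steps no surplus is left, i.e. the multigraph
-- has become a simple bipartite graph on (a ∘ 1^t, b ∘ 1^t).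
{-# OPTIONS --safe #-}
module Submission where

open import Defs
open import Data.Bool using (Bool; true; false; if_then_else_)
open import Data.Fin using (Fin; zero; suc; toℕ)
open import Data.Fin.Properties using (toℕ-injective)
open import Data.List using (List; []; _∷_; length; lookup; _++_)
open import Data.List.Relation.Binary.Pointwise using (≡⇒Pointwise-≡)
open import Data.List.Relation.Ternary.Interleaving.Propositional
  using (Interleaving; []; consˡ; consʳ; left; right; swap; toPermutation)
open import Data.List.Relation.Ternary.Interleaving.Properties using (++-disjoint)
open import Data.Nat using (ℕ; zero; suc; _+_; _*_; _∸_; _≤_; _<_; _<?_; _<ᵇ_; z≤n; s≤s; ⌊_/2⌋)
open import Data.Nat.ListAction using (sum)
open import Data.Nat.ListAction.Properties using (sum-++; sum-↭)
open import Data.Nat.Properties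
open import Algebra.Properties.CommutativeSemigroup +-commutativeSemigroup
  using (interchange; x∙yz≈y∙xz)
open import Data.Product using (Σ; _×_; _,_; ∃; ∃₂)
open import Data.Sum using (_⊎_; inj₁; inj₂; [_,_]′; map₁; map₂)
open import Function using (_∘_)
open import Function.Bundles using (_⇔_; mk⇔; Equivalence)
open import Function.Construct.Composition using (_⇔-∘_)
open import Function.Construct.Identity using (⇔-id)
open import Function.Construct.Symmetry using (⇔-sym)
open import Relation.Binary.Definitions using (tri<; tri≈; tri>)
open import Relation.Binary.PropositionalEquality
open import Relation.Nullary using (yes; no; does)
open import Relation.Nullary.Decidable using (dec-true; dec-false)

Σ-cong : ∀ n {f g : Fin n → ℕ} → (∀ i → f i ≡ g i) → Σ[< n ] f ≡ Σ[< n ] g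
Σ-cong zero    f≗g = refl
Σ-cong (suc n) f≗g = cong₂ _+_ (f≗g zero) (Σ-cong n (f≗g ∘ suc))

Σ-mono-≤ : ∀ n {f g : Fin n → ℕ} → (∀ i → f i ≤ g i) → Σ[< n ] f ≤ Σ[< n ] g
Σ-mono-≤ zero    f≤g = z≤n
Σ-mono-≤ (suc n) f≤g = +-mono-≤ (f≤g zero) (Σ-mono-≤ n (f≤g ∘ suc))

Σ-zero : ∀ n → Σ[< n ] (λ _ → 0) ≡ 0
Σ-zero zero    = refl
Σ-zero (suc n) = Σ-zero n

Σ-distrib-+ : ∀ n (f g : Fin n → ℕ) → Σ[< n ] (λ i → f i + g i) ≡ Σ[< n ] f + Σ[< n ] g
Σ-distrib-+ zero    f g = refl
Σ-distrib-+ (suc n) f g = begin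
  (f zero + g zero) + Σ[< n ] (λ i → f (suc i) + g (suc i))
    ≡⟨ cong (f zero + g zero +_) (Σ-distrib-+ n (f ∘ suc) (g ∘ suc)) ⟩
  (f zero + g zero) + (Σ[< n ] (f ∘ suc) + Σ[< n ] (g ∘ suc))
    ≡⟨ interchange (f zero) (g zero) _ _ ⟩
  Σ[< suc n ] f + Σ[< suc n ] g ∎
  where open ≡-Reasoning

*-distribˡ-Σ : ∀ n c (f : Fin n → ℕ) → c * Σ[< n ] f ≡ Σ[< n ] (λ i → c * f i)
*-distribˡ-Σ zero    c f = *-zeroʳ c
*-distribˡ-Σ (suc n) c f =
  trans (*-distribˡ-+ c (f zero) _) (cong (c * f zero +_) (*-distribˡ-Σ n c (f ∘ suc)))

*-distribʳ-Σ : ∀ n c (f : Fin n → ℕ) → Σ[< n ] f * c ≡ Σ[< n ] (λ i → f i * c)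
*-distribʳ-Σ n c f = begin
  Σ[< n ] f * c              ≡⟨ *-comm _ c ⟩
  c * Σ[< n ] f              ≡⟨ *-distribˡ-Σ n c f ⟩
  Σ[< n ] (λ i → c * f i)   ≡⟨ Σ-cong n (λ i → *-comm c (f i)) ⟩
  Σ[< n ] (λ i → f i * c)   ∎
  where open ≡-Reasoning

Σ-comm : ∀ n m (f : Fin n → Fin m → ℕ) →
  Σ[< n ] (λ i → Σ[< m ] (f i)) ≡ Σ[< m ] (λ j → Σ[< n ] (λ i → f i j))
Σ-comm zero    m f = sym (Σ-zero m)
Σ-comm (suc n) m f = begin
  Σ[< m ] (f zero) + Σ[< n ] (λ i → Σ[< m ] (f (suc i)))
    ≡⟨ cong (Σ[< m ] (f zero) +_) (Σ-comm n m (f ∘ suc)) ⟩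
  Σ[< m ] (f zero) + Σ[< m ] (λ j → Σ[< n ] (λ i → f (suc i) j))
    ≡⟨ Σ-distrib-+ m (f zero) _ ⟨
  Σ[< m ] (λ j → Σ[< suc n ] (λ i → f i j)) ∎
  where open ≡-Reasoning

≤-Σ : ∀ n (f : Fin n → ℕ) i → f i ≤ Σ[< n ] f
≤-Σ (suc n) f zero    = m≤m+n _ _
≤-Σ (suc n) f (suc i) = ≤-trans (≤-Σ n (f ∘ suc) i) (m≤n+m _ _)

Σ≡0⇒≡0 : ∀ n (f : Fin n → ℕ) → Σ[< n ] f ≡ 0 → ∀ i → f i ≡ 0
Σ≡0⇒≡0 n f Σf≡0 i = n≤0⇒n≡0 (subst (f i ≤_) Σf≡0 (≤-Σ n f i))

Σ>0⇒∃>0 : ∀ n (f : Fin n → ℕ) → 0 < Σ[< n ] f → ∃ λ i → 0 < f i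
Σ>0⇒∃>0 (suc n) f Σf>0 with f zero in eq
... | suc _ = zero , subst (0 <_) (sym eq) (s≤s z≤n)
... | zero with Σ>0⇒∃>0 n (f ∘ suc) Σf>0
...   | i , fi>0 = suc i , fi>0

+Σ≡1⇒≤1 : ∀ n e (f : Fin n → ℕ) → e + Σ[< n ] f ≡ 1 → ∀ i → f i ≤ 1
+Σ≡1⇒≤1 n e f e+Σf≡1 i = ≤-trans (≤-Σ n f i) (subst (Σ[< n ] f ≤_) e+Σf≡1 (m≤n+m _ e))

lowerΣ : ∀ n → (Fin n → Fin n → ℕ) → ℕ
lowerΣ n f = Σ[< n ] (λ i → Σ[< n ] (λ j → if does (toℕ j <? toℕ i) then f i j else 0))

ΣΣ≡lowerΣ+lowerΣ : ∀ n (f : Fin n → Fin n → ℕ) →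
  (∀ i j → f i j ≡ f j i) → (∀ i → f i i ≡ 0) →
  Σ[< n ] (λ i → Σ[< n ] (f i)) ≡ lowerΣ n f + lowerΣ n f
ΣΣ≡lowerΣ+lowerΣ n f sym-f diag-f = begin
  Σ[< n ] (λ i → Σ[< n ] (f i))
    ≡⟨ Σ-cong n (λ i → Σ-cong n (split-diagonal i)) ⟩
  Σ[< n ] (λ i → Σ[< n ] (λ j → low i j + low j i))
    ≡⟨ Σ-cong n (λ i → Σ-distrib-+ n (low i) (λ j → low j i)) ⟩
  Σ[< n ] (λ i → Σ[< n ] (low i) + Σ[< n ] (λ j → low j i))
    ≡⟨ Σ-distrib-+ n _ _ ⟩
  lowerΣ n f + Σ[< n ] (λ i → Σ[< n ] (λ j → low j i))
    ≡⟨ cong (lowerΣ n f +_) (Σ-comm n n (λ i j → low j i)) ⟩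
  lowerΣ n f + lowerΣ n f ∎
  where
  open ≡-Reasoning
  low : Fin n → Fin n → ℕ
  low i j = if does (toℕ j <? toℕ i) then f i j else 0
  split-diagonal : ∀ i j → f i j ≡ low i j + low j i
  split-diagonal i j with <-cmp (toℕ j) (toℕ i)
  ... | tri< j<i _ i≮j rewrite dec-true (toℕ j <? toℕ i) j<i | dec-false (toℕ i <? toℕ j) i≮j =
    sym (+-identityʳ (f i j))
  ... | tri> j≮i _ i<j rewrite dec-false (toℕ j <? toℕ i) j≮i | dec-true (toℕ i <? toℕ j) i<j =
    sym-f i j
  ... | tri≈ j≮i j≡i i≮j rewrite dec-false (toℕ j <? toℕ i) j≮i | dec-false (toℕ i <? toℕ j) i≮j
                                | toℕ-injective j≡i = diag-f i

TotMult-double : ∀ {n} (H : Multigraph n) →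
  TotMult H + TotMult H ≡ Σ[< n ] (λ x → Σ[< n ] (λ y → mult H x y ∸ 1))
TotMult-double {n} H = sym (ΣΣ≡lowerΣ+lowerΣ n (λ x y → mult H x y ∸ 1)
  (λ x y → cong (_∸ 1) (symmetric H x y)) (λ x → cong (_∸ 1) (loopless H x)))

double-injective : ∀ {m n} → m + m ≡ n + n → m ≡ n
double-injective {m} {n} eq = begin
  m               ≡⟨ n≡⌊n+n/2⌋ m ⟩
  ⌊ m + m /2⌋     ≡⟨ cong ⌊_/2⌋ eq ⟩
  ⌊ n + n /2⌋     ≡⟨ n≡⌊n+n/2⌋ n ⟨
  n               ∎
  where open ≡-Reasoning

-- Interleavings as splittings of positions

Σ⊎ : ∀ {n m} → (Fin n ⊎ Fin m → ℕ) → ℕ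
Σ⊎ {n} {m} g = Σ[< n ] (g ∘ inj₁) + Σ[< m ] (g ∘ inj₂)

split : ∀ {a b d : List ℕ} → Interleaving a b d → Fin (length d) → Fin (length a) ⊎ Fin (length b)
split (consˡ p) zero    = inj₁ zero
split (consˡ p) (suc x) = map₁ suc (split p x)
split (consʳ p) zero    = inj₂ zero
split (consʳ p) (suc x) = map₂ suc (split p x)

join : ∀ {a b d : List ℕ} → Interleaving a b d → Fin (length a) ⊎ Fin (length b) → Fin (length d)
join (consˡ p) (inj₁ zero)    = zero
join (consˡ p) (inj₁ (suc i)) = suc (join p (inj₁ i))
join (consˡ p) (inj₂ j)       = suc (join p (inj₂ j))
join (consʳ p) (inj₁ i)       = suc (join p (inj₁ i))
join (consʳ p) (inj₂ zero)    = zero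
join (consʳ p) (inj₂ (suc j)) = suc (join p (inj₂ j))

join-split : ∀ {a b d : List ℕ} (p : Interleaving a b d) x → join p (split p x) ≡ x
join-split (consˡ p) zero = refl
join-split (consˡ p) (suc x) with split p x | join-split p x
... | inj₁ i | eq = cong suc eq
... | inj₂ j | eq = cong suc eq
join-split (consʳ p) zero = refl
join-split (consʳ p) (suc x) with split p x | join-split p x
... | inj₁ i | eq = cong suc eq
... | inj₂ j | eq = cong suc eq

split-join : ∀ {a b d : List ℕ} (p : Interleaving a b d) s → split p (join p s) ≡ s
split-join (consˡ p) (inj₁ zero)    = refl
split-join (consˡ p) (inj₁ (suc i)) = cong (map₁ suc) (split-join p (inj₁ i))
split-join (consˡ p) (inj₂ j)       = cong (map₁ suc) (split-join p (inj₂ j))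
split-join (consʳ p) (inj₁ i)       = cong (map₂ suc) (split-join p (inj₁ i))
split-join (consʳ p) (inj₂ zero)    = refl
split-join (consʳ p) (inj₂ (suc j)) = cong (map₂ suc) (split-join p (inj₂ j))

lookup-join : ∀ {a b d : List ℕ} (p : Interleaving a b d) s →
  lookup d (join p s) ≡ [ lookup a , lookup b ]′ s
lookup-join (consˡ p) (inj₁ zero)    = refl
lookup-join (consˡ p) (inj₁ (suc i)) = lookup-join p (inj₁ i)
lookup-join (consˡ p) (inj₂ j)       = lookup-join p (inj₂ j)
lookup-join (consʳ p) (inj₁ i)       = lookup-join p (inj₁ i)
lookup-join (consʳ p) (inj₂ zero)    = refl
lookup-join (consʳ p) (inj₂ (suc j)) = lookup-join p (inj₂ j)

lookup-split : ∀ {a b d : List ℕ} (p : Interleaving a b d) x →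
  lookup d x ≡ [ lookup a , lookup b ]′ (split p x)
lookup-split {d = d} p x = begin
  lookup d x                        ≡⟨ cong (lookup d) (join-split p x) ⟨
  lookup d (join p (split p x))     ≡⟨ lookup-join p (split p x) ⟩
  [ _ , _ ]′ (split p x)            ∎
  where open ≡-Reasoning

Σ-split : ∀ {a b d : List ℕ} (p : Interleaving a b d) (g : Fin (length a) ⊎ Fin (length b) → ℕ) →
  Σ[< length d ] (g ∘ split p) ≡ Σ⊎ g
Σ-split [] g = refl
Σ-split (consˡ p) g =
  trans (cong (g (inj₁ zero) +_) (Σ-split p (g ∘ map₁ suc))) (sym (+-assoc (g (inj₁ zero)) _ _))
Σ-split {a} (consʳ p) g =
  trans (cong (g (inj₂ zero) +_) (Σ-split p (g ∘ map₂ suc)))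
        (x∙yz≈y∙xz (g (inj₂ zero)) (Σ[< length a ] (g ∘ inj₁)) _)

Σ-join : ∀ {a b d : List ℕ} (p : Interleaving a b d) (f : Fin (length d) → ℕ) →
  Σ[< length d ] f ≡ Σ⊎ (f ∘ join p)
Σ-join {d = d} p f =
  trans (Σ-cong (length d) (λ x → cong f (sym (join-split p x)))) (Σ-split p (f ∘ join p))

Σ-reindex : ∀ {a b d d′ : List ℕ} (p : Interleaving a b d) (q : Interleaving a b d′)
  (f : Fin (length d) → ℕ) →
  Σ[< length d′ ] (f ∘ join p ∘ split q) ≡ Σ[< length d ] f
Σ-reindex p q f = trans (Σ-split q (f ∘ join p)) (sym (Σ-join p f))

lookup-reindex : ∀ {a b d d′ : List ℕ} (p : Interleaving a b d) (q : Interleaving a b d′) x →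
  lookup d (join p (split q x)) ≡ lookup d′ x
lookup-reindex p q x = trans (lookup-join p (split q x)) (sym (lookup-split q x))

isLeft : ∀ {n m} → Fin n ⊎ Fin m → Bool
isLeft (inj₁ _) = true
isLeft (inj₂ _) = false

partitionBy : (d : List ℕ) (c : Fin (length d) → Bool) →
  ∃₂ λ a b → Σ (Interleaving a b d) λ p → ∀ s → c (join p s) ≡ isLeft s
partitionBy []      c = [] , [] , [] , λ { (inj₁ ()) ; (inj₂ ()) }
partitionBy (x ∷ d) c with partitionBy d (c ∘ suc) | c zero in c₀
... | a , b , p , colour | true  = x ∷ a , b , consˡ p , λ
  { (inj₁ zero) → c₀ ; (inj₁ (suc i)) → colour (inj₁ i) ; (inj₂ j) → colour (inj₂ j) }
... | a , b , p , colour | false = a , x ∷ b , consʳ p , λ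
  { (inj₁ i) → colour (inj₁ i) ; (inj₂ zero) → c₀ ; (inj₂ (suc j)) → colour (inj₂ j) }

++-interleaves : (a b : List ℕ) → Interleaving a b (a ++ b)
++-interleaves a b = ++-disjoint (left (≡⇒Pointwise-≡ refl)) (right (≡⇒Pointwise-≡ refl))

sum-interleaving : ∀ {a b d : List ℕ} → Interleaving a b d → sum d ≡ sum a + sum b
sum-interleaving {a} {b} p = trans (sum-↭ (toPermutation p)) (sum-++ a b)

sum≡Σlookup : (l : List ℕ) → sum l ≡ Σ[< length l ] (lookup l)
sum≡Σlookup []      = refl
sum≡Σlookup (x ∷ l) = cong (x +_) (sum≡Σlookup l)

excess : ∀ {n m} → (Fin n → Fin m → ℕ) → ℕ
excess {n} {m} M = Σ[< n ] (λ i → Σ[< m ] (λ j → M i j ∸ 1))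

record TotBigraphicPair (k : ℕ) (a b : List ℕ) : Set where
  field
    mat     : Fin (length a) → Fin (length b) → ℕ
    rowSum  : ∀ i → Σ[< length b ] (mat i) ≡ lookup a i
    colSum  : ∀ j → Σ[< length a ] (λ i → mat i j) ≡ lookup b j
    excess≤ : excess mat ≤ k

transpose : ∀ {k a b} → TotBigraphicPair k a b → TotBigraphicPair k b a
transpose {a = a} {b} R = record
  { mat     = λ j i → mat i j
  ; rowSum  = colSum
  ; colSum  = rowSum
  ; excess≤ = subst (_≤ _) (Σ-comm (length a) (length b) (λ i j → mat i j ∸ 1)) excess≤
  }
  where open TotBigraphicPair R

reindexRows : ∀ {k x y a a′ b} → Interleaving x y a → Interleaving x y a′ →
  TotBigraphicPair k a b → TotBigraphicPair k a′ b
reindexRows {a = a} {a′} {b} p q R = record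
  { mat     = mat ∘ π
  ; rowSum  = λ i → trans (rowSum (π i)) (lookup-reindex p q i)
  ; colSum  = λ j → trans (Σ-reindex p q (λ i → mat i j)) (colSum j)
  ; excess≤ = subst (_≤ _) (sym (Σ-reindex p q (λ i → Σ[< length b ] (λ j → mat i j ∸ 1)))) excess≤
  }
  where
  open TotBigraphicPair R
  π : Fin (length a′) → Fin (length a)
  π = join p ∘ split q

reorder : ∀ {k x y a a′ u v b b′} →
  Interleaving x y a → Interleaving x y a′ → Interleaving u v b → Interleaving u v b′ →
  TotBigraphicPair k a b → TotBigraphicPair k a′ b′
reorder p q p′ q′ = transpose ∘ reindexRows p′ q′ ∘ transpose ∘ reindexRows p q

balanced : ∀ {k a b} → TotBigraphicPair k a b → sum a ≡ sum b
balanced {a = a} {b} R = begin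
  sum a                                                   ≡⟨ sum≡Σlookup a ⟩
  Σ[< length a ] (lookup a)                               ≡⟨ Σ-cong _ rowSum ⟨
  Σ[< length a ] (λ i → Σ[< length b ] (mat i))           ≡⟨ Σ-comm _ _ mat ⟩
  Σ[< length b ] (λ j → Σ[< length a ] (λ i → mat i j))   ≡⟨ Σ-cong _ colSum ⟩
  Σ[< length b ] (lookup b)                               ≡⟨ sum≡Σlookup b ⟨
  sum b                                                   ∎
  where open TotBigraphicPair R
        open ≡-Reasoning

Bigraphic⇔TotBigraphicPair₀ : ∀ {a b} → Bigraphic a b ⇔ TotBigraphicPair 0 a b
Bigraphic⇔TotBigraphicPair₀ {a} {b} = mk⇔ to from
  where
  indicator : Bool → ℕ
  indicator x = if x then 1 else 0

  indicator∸1 : ∀ x → indicator x ∸ 1 ≡ 0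
  indicator∸1 true  = refl
  indicator∸1 false = refl

  to : Bigraphic a b → TotBigraphicPair 0 a b
  to (E , rows , cols) = record
    { mat     = λ i j → indicator (E i j)
    ; rowSum  = rows
    ; colSum  = cols
    ; excess≤ = ≤-reflexive (trans
        (Σ-cong _ (λ i → trans (Σ-cong _ (λ j → indicator∸1 (E i j))) (Σ-zero (length b))))
        (Σ-zero (length a)))
    }

  indicator-positive : ∀ x → x ≤ 1 → indicator (0 <ᵇ x) ≡ x
  indicator-positive zero          _ = refl
  indicator-positive (suc zero)    _ = refl
  indicator-positive (suc (suc x)) (s≤s ())

  from : TotBigraphicPair 0 a b → Bigraphic a b
  from R = (λ i j → 0 <ᵇ mat i j)
         , (λ i → trans (Σ-cong _ (λ j → entry≡ i j)) (rowSum i))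
         , (λ j → trans (Σ-cong _ (λ i → entry≡ i j)) (colSum j))
    where
    open TotBigraphicPair R
    entry≤1 : ∀ i j → mat i j ≤ 1
    entry≤1 i j = m∸n≡0⇒m≤n
      (Σ≡0⇒≡0 _ _ (Σ≡0⇒≡0 (length a) _ (n≤0⇒n≡0 excess≤) i) j)
    entry≡ : ∀ i j → indicator (0 <ᵇ mat i j) ≡ mat i j
    entry≡ i j = indicator-positive (mat i j) (entry≤1 i j)

-- Appending a vertex of degree 1 to each side

_⊗_ : ∀ {n m} → (Fin n → ℕ) → (Fin m → ℕ) → Fin n → Fin m → ℕ
(g ⊗ h) i j = g i * h j

row-+⊗ : ∀ n m (A : Fin n → Fin m → ℕ) g h i → g i * Σ[< m ] h ≡ g i →
  Σ[< m ] (λ j → A i j + (g ⊗ h) i j) ≡ g i + Σ[< m ] (A i)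
row-+⊗ n m A g h i scale = begin
  Σ[< m ] (λ j → A i j + (g ⊗ h) i j)   ≡⟨ Σ-distrib-+ m (A i) _ ⟩
  Σ[< m ] (A i) + Σ[< m ] ((g ⊗ h) i)   ≡⟨ cong (Σ[< m ] (A i) +_) (*-distribˡ-Σ m (g i) h) ⟨
  Σ[< m ] (A i) + g i * Σ[< m ] h       ≡⟨ cong (Σ[< m ] (A i) +_) scale ⟩
  Σ[< m ] (A i) + g i                   ≡⟨ +-comm _ (g i) ⟩
  g i + Σ[< m ] (A i)                   ∎
  where open ≡-Reasoning

col-+⊗ : ∀ n m (A : Fin n → Fin m → ℕ) g h j → Σ[< n ] g * h j ≡ h j →
  Σ[< n ] (λ i → A i j + (g ⊗ h) i j) ≡ h j + Σ[< n ] (λ i → A i j)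
col-+⊗ n m A g h j scale = begin
  Σ[< n ] (λ i → A i j + (g ⊗ h) i j)               ≡⟨ Σ-distrib-+ n (λ i → A i j) _ ⟩
  Σ[< n ] (λ i → A i j) + Σ[< n ] (λ i → g i * h j) ≡⟨ cong (_ +_) (*-distribʳ-Σ n (h j) g) ⟨
  Σ[< n ] (λ i → A i j) + Σ[< n ] g * h j           ≡⟨ cong (_ +_) scale ⟩
  Σ[< n ] (λ i → A i j) + h j                       ≡⟨ +-comm _ (h j) ⟩
  h j + Σ[< n ] (λ i → A i j)                       ∎
  where open ≡-Reasoning

excess-+⊗ : ∀ n m (A : Fin n → Fin m → ℕ) g h →
  Σ[< n ] (λ i → Σ[< m ] (λ j → (A i j ∸ 1) + (g ⊗ h) i j)) ≡ excess A + Σ[< n ] g * Σ[< m ] h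
excess-+⊗ n m A g h = begin
  Σ[< n ] (λ i → Σ[< m ] (λ j → (A i j ∸ 1) + (g ⊗ h) i j))
    ≡⟨ trans (Σ-cong n (λ i → Σ-distrib-+ m _ _)) (Σ-distrib-+ n _ _) ⟩
  excess A + Σ[< n ] (λ i → Σ[< m ] ((g ⊗ h) i))
    ≡⟨ cong (excess A +_) (Σ-cong n (λ i → *-distribˡ-Σ m (g i) h)) ⟨
  excess A + Σ[< n ] (λ i → g i * Σ[< m ] h)
    ≡⟨ cong (excess A +_) (*-distribʳ-Σ n _ g) ⟨
  excess A + Σ[< n ] g * Σ[< m ] h ∎
  where open ≡-Reasoning

-- A realisation of (1 ∷ a , 1 ∷ b) cut along its two new vertices of degree 1: their
-- mutual multiplicity is the corner, their edges to the old vertices are column and row.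
record Border (k : ℕ) (a b : List ℕ) : Set where
  field
    corner       : ℕ
    column       : Fin (length a) → ℕ
    row          : Fin (length b) → ℕ
    inner        : Fin (length a) → Fin (length b) → ℕ
    cornerRow    : corner + Σ[< length b ] row ≡ 1
    cornerColumn : corner + Σ[< length a ] column ≡ 1
    rowSum       : ∀ i → column i + Σ[< length b ] (inner i) ≡ lookup a i
    colSum       : ∀ j → row j + Σ[< length a ] (λ i → inner i j) ≡ lookup b j
    excess≤      : excess inner ≤ k

border : ∀ {n m} → ℕ → (Fin n → ℕ) → (Fin m → ℕ) → (Fin n → Fin m → ℕ) →
  Fin (suc n) → Fin (suc m) → ℕ
border e g h A zero    zero    = e
border e g h A zero    (suc j) = h j
border e g h A (suc i) zero    = g i
border e g h A (suc i) (suc j) = A i j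

Border⇒TotBigraphicPair : ∀ {k a b} → Border k a b → TotBigraphicPair k (1 ∷ a) (1 ∷ b)
Border⇒TotBigraphicPair {k} {a} {b} B = record
  { mat     = border corner column row inner
  ; rowSum  = λ { zero → cornerRow ; (suc i) → rowSum i }
  ; colSum  = λ { zero → cornerColumn ; (suc j) → colSum j }
  ; excess≤ = subst (_≤ k) (sym excess-border) excess≤
  }
  where
  open Border B
  excess-border : excess (border corner column row inner) ≡ excess inner
  excess-border = cong₂ _+_
    (cong₂ _+_ (m≤n⇒m∸n≡0 (subst (corner ≤_) cornerRow (m≤m+n _ _)))
               (trans (Σ-cong _ (λ j → m≤n⇒m∸n≡0 (+Σ≡1⇒≤1 _ corner row cornerRow j))) (Σ-zero (length b))))
    (Σ-cong _ (λ i → cong (_+ Σ[< length b ] (λ j → inner i j ∸ 1))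
                            (m≤n⇒m∸n≡0 (+Σ≡1⇒≤1 _ corner column cornerColumn i))))

TotBigraphicPair⇒Border : ∀ {k a b} → TotBigraphicPair k (1 ∷ a) (1 ∷ b) → Border k a b
TotBigraphicPair⇒Border {a = a} R = record
  { corner       = mat zero zero
  ; column       = λ i → mat (suc i) zero
  ; row          = λ j → mat zero (suc j)
  ; inner        = λ i j → mat (suc i) (suc j)
  ; cornerRow    = rowSum zero
  ; cornerColumn = colSum zero
  ; rowSum       = rowSum ∘ suc
  ; colSum       = colSum ∘ suc
  ; excess≤      = ≤-trans (≤-trans (Σ-mono-≤ (length a) (λ i → m≤n+m _ _)) (m≤n+m _ _)) excess≤
  }
  where open TotBigraphicPair R

[m+n]∸1≤[m∸1]+n : ∀ m n → (m + n) ∸ 1 ≤ (m ∸ 1) + n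
[m+n]∸1≤[m∸1]+n zero    n = m∸n≤m n 1
[m+n]∸1≤[m∸1]+n (suc m) n = ≤-refl

m∸1≡[m∸n]∸1+n : ∀ {m n} → n ≤ m ∸ 1 → m ∸ 1 ≡ (m ∸ n) ∸ 1 + n
m∸1≡[m∸n]∸1+n {m} {n} n≤m∸1 = begin
  m ∸ 1                 ≡⟨ m∸n+n≡m n≤m∸1 ⟨
  (m ∸ 1) ∸ n + n       ≡⟨ cong (_+ n) (∸-+-assoc m 1 n) ⟩
  m ∸ (1 + n) + n       ≡⟨ cong (λ x → m ∸ x + n) (+-comm 1 n) ⟩
  m ∸ (n + 1) + n       ≡⟨ cong (_+ n) (∸-+-assoc m n 1) ⟨
  (m ∸ n) ∸ 1 + n       ∎
  where open ≡-Reasoning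

unit-scale : ∀ {e x y} c → c ≤ y → e + x ≡ 1 → e + y ≡ 1 → c * x ≡ c
unit-scale {zero}        c _   x≡1 _     = trans (cong (c *_) x≡1) (*-identityʳ c)
unit-scale {suc zero}    c c≤y _   1+y≡1
  rewrite n≤0⇒n≡0 (subst (c ≤_) (suc-injective 1+y≡1) c≤y) = refl
unit-scale {suc (suc e)} c _   ()  _

Border⇒TotBigraphicPair-suc : ∀ {k a b} → Border k a b → TotBigraphicPair (suc k) a b
Border⇒TotBigraphicPair-suc {k} {a} {b} B = record
  { mat     = M
  ; rowSum  = λ i → trans (row-+⊗ n m inner column row i
                             (unit-scale (column i) (≤-Σ n column i) cornerRow cornerColumn))
                           (rowSum i)
  ; colSum  = λ j → trans (col-+⊗ n m inner column row j (trans (*-comm _ (row j))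
                             (unit-scale (row j) (≤-Σ m row j) cornerColumn cornerRow)))
                           (colSum j)
  ; excess≤ = excessM≤
  }
  where
  open Border B
  n = length a
  m = length b
  M : Fin n → Fin m → ℕ
  M i j = inner i j + (column ⊗ row) i j
  excessM≤ : excess M ≤ suc k
  excessM≤ = begin
    excess M
      ≤⟨ Σ-mono-≤ n (λ i → Σ-mono-≤ m (λ j → [m+n]∸1≤[m∸1]+n (inner i j) _)) ⟩
    Σ[< n ] (λ i → Σ[< m ] (λ j → (inner i j ∸ 1) + (column ⊗ row) i j))
      ≡⟨ excess-+⊗ n m inner column row ⟩
    excess inner + Σ[< n ] column * Σ[< m ] row
      ≤⟨ +-mono-≤ excess≤ (*-mono-≤ (subst (Σ[< n ] column ≤_) cornerColumn (m≤n+m _ corner))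
                                     (subst (Σ[< m ] row ≤_) cornerRow (m≤n+m _ corner))) ⟩
    k + 1
      ≡⟨ +-comm k 1 ⟩
    suc k ∎
    where open ≤-Reasoning

δ : ∀ {n} → Fin n → Fin n → ℕ
δ zero    zero    = 1
δ zero    (suc _) = 0
δ (suc _) zero    = 0
δ (suc i) (suc j) = δ i j

Σ-δ : ∀ n (i : Fin n) → Σ[< n ] (δ i) ≡ 1
Σ-δ (suc n) zero    = cong suc (Σ-zero n)
Σ-δ (suc n) (suc i) = Σ-δ n i

δ-cases : ∀ {n} (i j : Fin n) → δ i j ≡ 0 ⊎ (i ≡ j × δ i j ≡ 1)
δ-cases zero    zero    = inj₂ (refl , refl)
δ-cases zero    (suc j) = inj₁ refl
δ-cases (suc i) zero    = inj₁ refl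
δ-cases (suc i) (suc j) with δ-cases i j
... | inj₁ δij≡0         = inj₁ δij≡0
... | inj₂ (refl , δii≡1) = inj₂ (refl , δii≡1)

δ⊗δ-≤ : ∀ {n m} (F : Fin n → Fin m → ℕ) i₀ j₀ → 1 ≤ F i₀ j₀ → ∀ i j → (δ i₀ ⊗ δ j₀) i j ≤ F i j
δ⊗δ-≤ F i₀ j₀ 1≤F i j with δ-cases i₀ i | δ-cases j₀ j
... | inj₁ δ≡0 | _ rewrite δ≡0 = z≤n
... | inj₂ _ | inj₁ δ≡0 rewrite δ≡0 | *-zeroʳ (δ i₀ i) = z≤n
... | inj₂ (refl , δ≡1) | inj₂ (refl , δ′≡1) rewrite δ≡1 | δ′≡1 = 1≤F

Border-isolatedEdge : ∀ {k a b} → TotBigraphicPair k a b → Border k a b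
Border-isolatedEdge {a = a} {b} R = record
  { corner       = 1
  ; column       = λ _ → 0
  ; row          = λ _ → 0
  ; inner        = mat
  ; cornerRow    = cong suc (Σ-zero (length b))
  ; cornerColumn = cong suc (Σ-zero (length a))
  ; rowSum       = rowSum
  ; colSum       = colSum
  ; excess≤      = excess≤
  }
  where open TotBigraphicPair R

Border-rerouteEdge : ∀ {k a b} (R : TotBigraphicPair (suc k) a b) i₀ j₀ →
  1 ≤ TotBigraphicPair.mat R i₀ j₀ ∸ 1 → Border k a b
Border-rerouteEdge {k} {a} {b} R i₀ j₀ 2≤mat₀ = record
  { corner       = 0
  ; column       = δ i₀
  ; row          = δ j₀
  ; inner        = inner
  ; cornerRow    = Σ-δ m j₀
  ; cornerColumn = Σ-δ n i₀
  ; rowSum       = λ i → trans (sym (row-+⊗ n m inner (δ i₀) (δ j₀) i (δ-scaleʳ i)))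
                               (trans (Σ-cong m (λ j → sym (mat≡ i j))) (rowSum i))
  ; colSum       = λ j → trans (sym (col-+⊗ n m inner (δ i₀) (δ j₀) j (δ-scaleˡ j)))
                               (trans (Σ-cong n (λ i → sym (mat≡ i j))) (colSum j))
  ; excess≤      = ≤-pred (subst (_≤ suc k) excess-mat excess≤)
  }
  where
  open TotBigraphicPair R
  open ≡-Reasoning
  n = length a
  m = length b
  E : Fin n → Fin m → ℕ
  E = δ i₀ ⊗ δ j₀
  E≤ : ∀ i j → E i j ≤ mat i j ∸ 1
  E≤ = δ⊗δ-≤ (λ i j → mat i j ∸ 1) i₀ j₀ 2≤mat₀
  inner : Fin n → Fin m → ℕ
  inner i j = mat i j ∸ E i j
  mat≡ : ∀ i j → mat i j ≡ inner i j + E i j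
  mat≡ i j = sym (m∸n+n≡m (≤-trans (E≤ i j) (m∸n≤m _ 1)))
  δ-scaleʳ : ∀ i → δ i₀ i * Σ[< m ] (δ j₀) ≡ δ i₀ i
  δ-scaleʳ i = trans (cong (δ i₀ i *_) (Σ-δ m j₀)) (*-identityʳ (δ i₀ i))
  δ-scaleˡ : ∀ j → Σ[< n ] (δ i₀) * δ j₀ j ≡ δ j₀ j
  δ-scaleˡ j = trans (cong (_* δ j₀ j) (Σ-δ n i₀)) (*-identityˡ (δ j₀ j))
  excess-mat : excess mat ≡ suc (excess inner)
  excess-mat = begin
    excess mat
      ≡⟨ Σ-cong n (λ i → Σ-cong m (λ j → m∸1≡[m∸n]∸1+n (E≤ i j))) ⟩
    Σ[< n ] (λ i → Σ[< m ] (λ j → (inner i j ∸ 1) + E i j))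
      ≡⟨ excess-+⊗ n m inner (δ i₀) (δ j₀) ⟩
    excess inner + Σ[< n ] (δ i₀) * Σ[< m ] (δ j₀)
      ≡⟨ cong₂ (λ x y → excess inner + x * y) (Σ-δ n i₀) (Σ-δ m j₀) ⟩
    excess inner + 1
      ≡⟨ +-comm _ 1 ⟩
    suc (excess inner) ∎

TotBigraphicPair-suc⇒Border : ∀ {k a b} → TotBigraphicPair (suc k) a b → Border k a b
TotBigraphicPair-suc⇒Border {k} {a} {b} R with excess (TotBigraphicPair.mat R) ≤? k
... | yes excess≤k = Border-isolatedEdge record { TotBigraphicPair R; excess≤ = excess≤k }
... | no  excess≰k =
  let i₀ , excess-row>0 = Σ>0⇒∃>0 (length a) _ (≤-trans (s≤s z≤n) (≰⇒> excess≰k))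
      j₀ , 2≤mat₀       = Σ>0⇒∃>0 (length b) _ excess-row>0
  in Border-rerouteEdge R i₀ j₀ 2≤mat₀

TotBigraphicPair-suc⇔ : ∀ {k a b} → TotBigraphicPair (suc k) a b ⇔ TotBigraphicPair k (1 ∷ a) (1 ∷ b)
TotBigraphicPair-suc⇔ = mk⇔ (Border⇒TotBigraphicPair ∘ TotBigraphicPair-suc⇒Border)
                            (Border⇒TotBigraphicPair-suc ∘ TotBigraphicPair⇒Border)

TotBigraphicPair-prependOnes : ∀ t k {a b} →
  TotBigraphicPair (k + t) a b ⇔ TotBigraphicPair k (ones t ++ a) (ones t ++ b)
TotBigraphicPair-prependOnes zero    k rewrite +-identityʳ k = ⇔-id _
TotBigraphicPair-prependOnes (suc t) k rewrite +-suc k t =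
  TotBigraphicPair-suc⇔ ⇔-∘ TotBigraphicPair-prependOnes t (suc k)

TotBigraphicPair⇔Bigraphic-appendOnes : ∀ t {a b} →
  TotBigraphicPair t a b ⇔ Bigraphic (a ++ ones t) (b ++ ones t)
TotBigraphicPair⇔Bigraphic-appendOnes t {a} {b} =
  ⇔-sym Bigraphic⇔TotBigraphicPair₀ ⇔-∘ (move-ones ⇔-∘ TotBigraphicPair-prependOnes t 0)
  where
  front : ∀ x → Interleaving x (ones t) (ones t ++ x)
  front x = swap (++-interleaves (ones t) x)
  move-ones : TotBigraphicPair 0 (ones t ++ a) (ones t ++ b) ⇔ TotBigraphicPair 0 (a ++ ones t) (b ++ ones t)
  move-ones = mk⇔ (reorder (front a) (++-interleaves a (ones t)) (front b) (++-interleaves b (ones t)))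
                  (reorder (++-interleaves a (ones t)) (front a) (++-interleaves b (ones t)) (front b))

-- Bipartite multigraphs on a degree sequence

adjacency : ∀ {n m} → (Fin n → Fin m → ℕ) → Fin n ⊎ Fin m → Fin n ⊎ Fin m → ℕ
adjacency M (inj₁ i) (inj₂ j) = M i j
adjacency M (inj₂ j) (inj₁ i) = M i j
adjacency M (inj₁ _) (inj₁ _) = 0
adjacency M (inj₂ _) (inj₂ _) = 0

adjacency-sym : ∀ {n m} (M : Fin n → Fin m → ℕ) s s′ → adjacency M s s′ ≡ adjacency M s′ s
adjacency-sym M (inj₁ i) (inj₁ i′) = refl
adjacency-sym M (inj₁ i) (inj₂ j)  = refl
adjacency-sym M (inj₂ j) (inj₁ i)  = refl
adjacency-sym M (inj₂ j) (inj₂ j′) = refl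

adjacency-diag : ∀ {n m} (M : Fin n → Fin m → ℕ) s → adjacency M s s ≡ 0
adjacency-diag M (inj₁ i) = refl
adjacency-diag M (inj₂ j) = refl

adjacency-∸1 : ∀ {n m} (M : Fin n → Fin m → ℕ) s s′ →
  adjacency M s s′ ∸ 1 ≡ adjacency (λ i j → M i j ∸ 1) s s′
adjacency-∸1 M (inj₁ i) (inj₁ i′) = refl
adjacency-∸1 M (inj₁ i) (inj₂ j)  = refl
adjacency-∸1 M (inj₂ j) (inj₁ i)  = refl
adjacency-∸1 M (inj₂ j) (inj₂ j′) = refl

adjacency-bipartite : ∀ {n m} (M : Fin n → Fin m → ℕ) s s′ → 1 ≤ adjacency M s s′ → isLeft s ≢ isLeft s′
adjacency-bipartite M (inj₁ i) (inj₂ j) _ ()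
adjacency-bipartite M (inj₂ j) (inj₁ i) _ ()

lineSum : ∀ {n m} → (Fin n → Fin m → ℕ) → Fin n ⊎ Fin m → ℕ
lineSum {m = m} M (inj₁ i) = Σ[< m ] (M i)
lineSum {n = n} M (inj₂ j) = Σ[< n ] (λ i → M i j)

Σ⊎-adjacency : ∀ {n m} (M : Fin n → Fin m → ℕ) s → Σ⊎ (adjacency M s) ≡ lineSum M s
Σ⊎-adjacency {n} {m} M (inj₁ i) = cong (_+ Σ[< m ] (M i)) (Σ-zero n)
Σ⊎-adjacency {n} {m} M (inj₂ j) = trans (cong (Σ[< n ] (λ i → M i j) +_) (Σ-zero m)) (+-identityʳ _)

Σ⊎-lineSum : ∀ {n m} (M : Fin n → Fin m → ℕ) →
  Σ⊎ (lineSum M) ≡ Σ[< n ] (λ i → Σ[< m ] (M i)) + Σ[< n ] (λ i → Σ[< m ] (M i))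
Σ⊎-lineSum {n} {m} M = cong (Σ[< n ] (λ i → Σ[< m ] (M i)) +_) (sym (Σ-comm n m M))

record IsBiadjacency {a b d : List ℕ} (p : Interleaving a b d)
  (M : Fin (length a) → Fin (length b) → ℕ) (H : Multigraph (length d)) : Set where
  field
    mult≡ : ∀ x y → mult H x y ≡ adjacency M (split p x) (split p y)
open IsBiadjacency

degree-biadjacency : ∀ {a b d : List ℕ} {p : Interleaving a b d} {M H} → IsBiadjacency p M H →
  ∀ x → degree H x ≡ lineSum M (split p x)
degree-biadjacency {d = d} {p} {M} {H} biadj x = begin
  Σ[< length d ] (mult H x)                               ≡⟨ Σ-cong (length d) (mult≡ biadj x) ⟩
  Σ[< length d ] (adjacency M (split p x) ∘ split p)     ≡⟨ Σ-split p (adjacency M (split p x)) ⟩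
  Σ⊎ (adjacency M (split p x))                            ≡⟨ Σ⊎-adjacency M (split p x) ⟩
  lineSum M (split p x)                                   ∎
  where open ≡-Reasoning

TotMult-biadjacency : ∀ {a b d : List ℕ} {p : Interleaving a b d} {M H} → IsBiadjacency p M H →
  TotMult H ≡ excess M
TotMult-biadjacency {a} {b} {d} {p} {M} {H} biadj = double-injective (begin
  TotMult H + TotMult H
    ≡⟨ TotMult-double H ⟩
  Σ[< length d ] (λ x → Σ[< length d ] (λ y → mult H x y ∸ 1))
    ≡⟨ Σ-cong (length d) (λ x → Σ-cong (length d) (λ y → cong (_∸ 1) (mult≡ biadj x y))) ⟩
  Σ[< length d ] (λ x → Σ[< length d ] (λ y → adjacency M (split p x) (split p y) ∸ 1))
    ≡⟨ Σ-cong (length d) (λ x → Σ-split p (λ s′ → adjacency M (split p x) s′ ∸ 1)) ⟩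
  Σ[< length d ] (λ x → Σ⊎ (λ s′ → adjacency M (split p x) s′ ∸ 1))
    ≡⟨ Σ-split p (λ s → Σ⊎ (λ s′ → adjacency M s s′ ∸ 1)) ⟩
  Σ⊎ (λ s → Σ⊎ (λ s′ → adjacency M s s′ ∸ 1))
    ≡⟨ cong₂ _+_ (Σ-cong (length a) (λ i → row-excess (inj₁ i))) (Σ-cong (length b) (λ j → row-excess (inj₂ j))) ⟩
  Σ⊎ (lineSum M∸1)
    ≡⟨ Σ⊎-lineSum M∸1 ⟩
  excess M + excess M ∎)
  where
  open ≡-Reasoning
  M∸1 : Fin (length a) → Fin (length b) → ℕ
  M∸1 i j = M i j ∸ 1
  row-excess : ∀ s → Σ⊎ (λ s′ → adjacency M s s′ ∸ 1) ≡ lineSum M∸1 s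
  row-excess s = trans (cong₂ _+_ (Σ-cong (length a) (adjacency-∸1 M s ∘ inj₁))
                                  (Σ-cong (length b) (adjacency-∸1 M s ∘ inj₂)))
                       (Σ⊎-adjacency M∸1 s)

biadjacencyMultigraph : ∀ {a b d : List ℕ} → Interleaving a b d →
  (Fin (length a) → Fin (length b) → ℕ) → Multigraph (length d)
biadjacencyMultigraph p M = record
  { mult      = λ x y → adjacency M (split p x) (split p y)
  ; symmetric = λ x y → adjacency-sym M (split p x) (split p y)
  ; loopless  = λ x → adjacency-diag M (split p x)
  }

TotBigraphicPair⇒TotBigraphic : ∀ {t a b d} → Interleaving a b d → TotBigraphicPair t a b → TotBigraphic t d
TotBigraphicPair⇒TotBigraphic {t} {a} {b} {d} p R = H , degrees , bipartite , TotMult≤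
  where
  open TotBigraphicPair R
  H : Multigraph (length d)
  H = biadjacencyMultigraph p mat
  biadj : IsBiadjacency p mat H
  biadj = record { mult≡ = λ x y → refl }
  lineSum≡ : ∀ s → lineSum mat s ≡ [ lookup a , lookup b ]′ s
  lineSum≡ (inj₁ i) = rowSum i
  lineSum≡ (inj₂ j) = colSum j
  degrees : HasDegrees d H
  degrees x = trans (degree-biadjacency biadj x) (trans (lineSum≡ (split p x)) (sym (lookup-split p x)))
  bipartite : IsBipartite H
  bipartite = isLeft ∘ split p , λ x y → adjacency-bipartite mat (split p x) (split p y)
  TotMult≤ : TotMult H ≤ t
  TotMult≤ = subst (_≤ t) (sym (TotMult-biadjacency biadj)) excess≤

TotBigraphic⇒TotBigraphicPair : ∀ {t d} → TotBigraphic t d →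
  ∃₂ λ a b → Interleaving a b d × TotBigraphicPair t a b
TotBigraphic⇒TotBigraphicPair {t} {d} (H , degrees , (c , proper) , TotMult≤) with partitionBy d c
... | a , b , p , colour = a , b , p , record
  { mat     = M
  ; rowSum  = lineSum≡ ∘ inj₁
  ; colSum  = lineSum≡ ∘ inj₂
  ; excess≤ = subst (_≤ t) (TotMult-biadjacency biadj) TotMult≤
  }
  where
  open ≡-Reasoning
  M : Fin (length a) → Fin (length b) → ℕ
  M i j = mult H (join p (inj₁ i)) (join p (inj₂ j))
  monochromatic : ∀ x y → c x ≡ c y → mult H x y ≡ 0
  monochromatic x y cx≡cy = n<1⇒n≡0 (≰⇒> (λ 1≤mult → proper x y 1≤mult cx≡cy))
  on-join : ∀ s s′ → mult H (join p s) (join p s′) ≡ adjacency M s s′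
  on-join (inj₁ i) (inj₁ i′) = monochromatic _ _ (trans (colour (inj₁ i)) (sym (colour (inj₁ i′))))
  on-join (inj₁ i) (inj₂ j)  = refl
  on-join (inj₂ j) (inj₁ i)  = symmetric H _ _
  on-join (inj₂ j) (inj₂ j′) = monochromatic _ _ (trans (colour (inj₂ j)) (sym (colour (inj₂ j′))))
  biadj : IsBiadjacency p M H
  biadj = record { mult≡ = λ x y → begin
    mult H x y                                         ≡⟨ cong₂ (mult H) (join-split p x) (join-split p y) ⟨
    mult H (join p (split p x)) (join p (split p y))   ≡⟨ on-join (split p x) (split p y) ⟩
    adjacency M (split p x) (split p y)                ∎ }
  lineSum≡ : ∀ s → lineSum M s ≡ [ lookup a , lookup b ]′ s
  lineSum≡ s = begin
    lineSum M s                    ≡⟨ cong (lineSum M) (split-join p s) ⟨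
    lineSum M (split p (join p s)) ≡⟨ degree-biadjacency biadj (join p s) ⟨
    degree H (join p s)            ≡⟨ degrees (join p s) ⟩
    lookup d (join p s)            ≡⟨ lookup-join p s ⟩
    [ lookup a , lookup b ]′ s     ∎

InBP-balanced : ∀ {a b d} → Interleaving a b d → sum a ≡ sum b → InBP d a b
InBP-balanced {a} {b} p Σa≡Σb =
  p , trans (cong (sum a +_) (trans (+-identityʳ (sum a)) Σa≡Σb)) (sym (sum-interleaving p))
    , trans (cong₂ _+_ (sym Σa≡Σb) (+-identityʳ (sum b))) (sym (sum-interleaving p))

theorem10 : (d : List ℕ) → DegreeSequence d → (t : ℕ) → 1 ≤ t →
    TotBigraphic t d ⇔ ∃₂ (λ a b → InBP d a b × Bigraphic (a ++ ones t) (b ++ ones t))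
theorem10 d _ t _ = mk⇔ to from
  where
  to : TotBigraphic t d → ∃₂ (λ a b → InBP d a b × Bigraphic (a ++ ones t) (b ++ ones t))
  to tot with TotBigraphic⇒TotBigraphicPair tot
  ... | a , b , p , R =
    a , b , InBP-balanced p (balanced R) , Equivalence.to (TotBigraphicPair⇔Bigraphic-appendOnes t) R
  from : ∃₂ (λ a b → InBP d a b × Bigraphic (a ++ ones t) (b ++ ones t)) → TotBigraphic t d
  from (a , b , (p , _) , G) =
    TotBigraphicPair⇒TotBigraphic p (Equivalence.from (TotBigraphicPair⇔Bigraphic-appendOnes t) G)
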